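{- Let $n\ge 3$, $a\in\mathbb{F}_2^n\setminus\{0\}$, let $\tau\in\mathrm{Per}(\mathbb{F}_2^n)$ be the transposition interchanging $0$ and $a$, and let $f\in\mathrm{AGL}(n,\mathbb{F}_2)$. (i) If $n\ge 4$, then $\tau\circ f\circ\tau\in\mathrm{AGL}(n,\mathbb{F}_2)$ if and only if $f(\{0,a\})=\{0,a\}$. (ii) If $n=3$, then $\tau\circ f\circ\tau\in\mathrm{AGL}(n,\mathbb{F}_2)$ if and only if $f(a)+f(0)=a$.
   Context: $\mathrm{AGL}(n,\mathbb{F}_2)$ is the group of invertible affine maps $x\mapsto xA+b$ of $\mathbb{F}_2^n$. -}

module Defs where

open import Data.Nat using (ℕ)
open import Data.Bool using (Bool; true; false; _xor_; if_then_else_)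
open import Data.Bool.Properties using () renaming (_≟_ to _≟B_)
open import Data.Vec using (Vec; []; _∷_; zipWith; replicate; map; tabulate)
open import Data.Vec.Properties using (≡-dec)
open import Data.Fin using (Fin)
open import Data.Fin.Properties using () renaming (_≟_ to _≟F_)
open import Data.Product using (Σ; _×_; ∃)
open import Data.Sum using (_⊎_)
open import Relation.Binary.PropositionalEquality using (_≡_)
open import Relation.Nullary using (yes; no; Dec)
open import Relation.Nullary.Decidable using (⌊_⌋)

-- The vector space F_2^n (row vectors), entries in Bool = F_2.
V : ℕ → Set
V n = Vec Bool n

-- n×n matrices over F_2, given as a vector of rows.
Mat : ℕ → Set
Mat n = Vec (Vec Bool n) n

zeroV : ∀ {n} → V n
zeroV = replicate _ false

_⊕_ : ∀ {n} → V n → V n → V n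
_⊕_ = zipWith _xor_

_≟V_ : ∀ {n} (x y : V n) → Dec (x ≡ y)
_≟V_ = ≡-dec _≟B_

_·_ : ∀ {m n} → Vec Bool m → Vec (Vec Bool n) m → V n
[] · [] = zeroV
(b ∷ x) · (r ∷ A) = (if b then r else zeroV) ⊕ (x · A)

_⊗_ : ∀ {n} → Mat n → Mat n → Mat n
A ⊗ B = map (λ r → r · B) A

idMat : ∀ {n} → Mat n
idMat = tabulate λ i → tabulate λ j → ⌊ i ≟F j ⌋

Invertible : ∀ {n} → Mat n → Set
Invertible {n} A = Σ (Mat n) λ B → (A ⊗ B ≡ idMat) × (B ⊗ A ≡ idMat)

InAGL : ∀ {n} → (V n → V n) → Set
InAGL {n} g = Σ (Mat n) λ A → Σ (V n) λ b →
  Invertible A × (∀ x → g x ≡ (x · A) ⊕ b)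

transp : ∀ {n} → V n → V n → V n
transp a x with x ≟V zeroV
... | yes _ = a
... | no _ with x ≟V a
...   | yes _ = zeroV
...   | no _ = x

InPair : ∀ {n} → V n → V n → Set
InPair a x = (x ≡ zeroV) ⊎ (x ≡ a)

MapsPairOnto : ∀ {n} → (V n → V n) → V n → Set
MapsPairOnto {n} f a =
  (∀ x → InPair a x → InPair a (f x)) ×
  (∀ y → InPair a y → ∃ λ x → InPair a x × (f x ≡ y))

{-# OPTIONS --safe #-}
-- Write p = f 0 and q = f a. Conjugating the transposition τ = (0 a) by f gives the
-- transposition (p q), so τ ∘ f ∘ τ = κ ∘ f with κ = (0 a)(p q), and τ ∘ f ∘ τ is affine
-- iff κ is. Affine maps of F₂ⁿ preserve sums x + y + z. Testing this for κ at points that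
-- avoid the few points κ moves (possible once 2ⁿ exceeds their number) shows that p and q
-- lie both in {0, a} or both outside it, that p + q = a in either case, and, for n ≥ 4,
-- that they cannot lie outside. Conversely κ is the identity when {p, q} = {0, a}; when
-- n = 3 and q = p + a ∉ {0, a}, the plane {0, a, p, p + a} is the kernel of u ↦ u ∙ c for
-- c = a × p, and κ is the affine involution u ↦ u + (1 + u ∙ c) a.
module Submission where

open import Defs
open import Data.Nat using (ℕ; _≤_)
open import Data.Product using (_×_)
open import Function using (_∘_)
open import Function.Bundles using (_⇔_)
open import Relation.Binary.PropositionalEquality using (_≡_; _≢_)

open import Algebra.Bundles using (CommutativeSemigroup)
open import Data.Bool using (Bool; true; false; _∧_; _xor_; if_then_else_)
open import Data.Bool.Properties
  using (xor-assoc; xor-comm; xor-identityˡ; xor-identityʳ; xor-same)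
  renaming (_≟_ to _≟B_)
open import Data.Empty using (⊥; ⊥-elim)
open import Data.Fin using (Fin)
open import Data.Fin.Properties using (suc-injective) renaming (_≟_ to _≟F_)
open import Data.Fin.Subset.Properties using (anySubset?)
open import Data.List using (List; []; _∷_; length)
open import Data.List.Membership.Propositional using (_∈_; _∉_)
open import Data.List.Relation.Unary.All using (All; []; _∷_)
open import Data.List.Relation.Unary.Any using (here; there; any?)
open import Data.Nat using (zero; suc; _<_; _^_; _+_; _<?_; s≤s)
open import Data.Nat.Properties
  using (≤-trans; ≤-reflexive; ≤-<-trans; <-≤-trans; <⇒≤; ≮⇒≥;
         +-monoˡ-≤; +-cancelˡ-<; +-suc; +-identityʳ; ^-monoʳ-≤)
open import Data.Product using (∃; _,_; proj₁; proj₂; uncurry)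
open import Data.Sum using (_⊎_; inj₁; inj₂; [_,_]′)
open import Data.Vec using (Vec; []; _∷_; map; zipWith; tabulate; allFin)
open import Data.Vec.Properties
  using (zipWith-assoc; zipWith-comm; zipWith-identityˡ; zipWith-identityʳ;
         ∷-injectiveˡ; ∷-injectiveʳ; map-∘; map-cong; map-id; map-const;
         tabulate-∘; tabulate-cong; tabulate-allFin)
open import Function using (id)
open import Function.Bundles using (mk⇔)
open import Relation.Binary.PropositionalEquality
  using (refl; sym; trans; cong; cong₂; subst; module ≡-Reasoning)
open import Relation.Binary.PropositionalEquality.Algebra using (isMagma)
open import Relation.Nullary using (¬_; Dec; yes; no; ¬?; contradiction)
open import Relation.Nullary.Decidable
  using (⌊_⌋; ⌊⌋-map′; True; toWitness; from-no; decidable-stable; _×-dec_; _→-dec_; _⊎-dec_)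

open ≡-Reasoning

private variable
  k m n : ℕ

⊕-assoc : (x y z : V n) → (x ⊕ y) ⊕ z ≡ x ⊕ (y ⊕ z)
⊕-assoc = zipWith-assoc xor-assoc

⊕-comm : (x y : V n) → x ⊕ y ≡ y ⊕ x
⊕-comm = zipWith-comm xor-comm

⊕-identityˡ : (x : V n) → zeroV ⊕ x ≡ x
⊕-identityˡ = zipWith-identityˡ xor-identityˡ

⊕-identityʳ : (x : V n) → x ⊕ zeroV ≡ x
⊕-identityʳ = zipWith-identityʳ xor-identityʳ

⊕-self : (x : V n) → x ⊕ x ≡ zeroV
⊕-self []      = refl
⊕-self (b ∷ x) = cong₂ _∷_ (xor-same b) (⊕-self x)

⊕-commutativeSemigroup : ℕ → CommutativeSemigroup _ _
⊕-commutativeSemigroup n = record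
  { Carrier                = V n
  ; _≈_                    = _≡_
  ; _∙_                    = _⊕_
  ; isCommutativeSemigroup = record
    { isSemigroup = record { isMagma = isMagma _⊕_ ; assoc = ⊕-assoc }
    ; comm        = ⊕-comm
    }
  }

⊕-interchange : (w x y z : V n) → (w ⊕ x) ⊕ (y ⊕ z) ≡ (w ⊕ y) ⊕ (x ⊕ z)
⊕-interchange {n} = interchange
  where open import Algebra.Properties.CommutativeSemigroup (⊕-commutativeSemigroup n)

x⊕[x⊕y]≡y : (x y : V n) → x ⊕ (x ⊕ y) ≡ y
x⊕[x⊕y]≡y x y = begin
  x ⊕ (x ⊕ y)  ≡⟨ ⊕-assoc x x y ⟨
  (x ⊕ x) ⊕ y  ≡⟨ cong (_⊕ y) (⊕-self x) ⟩
  zeroV ⊕ y    ≡⟨ ⊕-identityˡ y ⟩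
  y            ∎

[x⊕y]⊕y≡x : (x y : V n) → (x ⊕ y) ⊕ y ≡ x
[x⊕y]⊕y≡x x y = begin
  (x ⊕ y) ⊕ y  ≡⟨ ⊕-assoc x y y ⟩
  x ⊕ (y ⊕ y)  ≡⟨ cong (x ⊕_) (⊕-self y) ⟩
  x ⊕ zeroV    ≡⟨ ⊕-identityʳ x ⟩
  x            ∎

[x⊕y]⊕x≡y : (x y : V n) → (x ⊕ y) ⊕ x ≡ y
[x⊕y]⊕x≡y x y = trans (cong (_⊕ x) (⊕-comm x y)) ([x⊕y]⊕y≡x y x)

x⊕y≡z⇒y≡x⊕z : {x y z : V n} → x ⊕ y ≡ z → y ≡ x ⊕ z
x⊕y≡z⇒y≡x⊕z {x = x} {y} refl = sym (x⊕[x⊕y]≡y x y)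

x⊕y≡0⇒y≡x : {x y : V n} → x ⊕ y ≡ zeroV → y ≡ x
x⊕y≡0⇒y≡x {x = x} e = trans (x⊕y≡z⇒y≡x⊕z e) (⊕-identityʳ x)

⊕-cancelˡ : {x y z : V n} → x ⊕ y ≡ x ⊕ z → y ≡ z
⊕-cancelˡ {x = x} {z = z} e = trans (x⊕y≡z⇒y≡x⊕z e) (x⊕[x⊕y]≡y x z)

⊕-cancelʳ : {x y z : V n} → y ⊕ x ≡ z ⊕ x → y ≡ z
⊕-cancelʳ {x = x} {y} {z} e = ⊕-cancelˡ (trans (⊕-comm x y) (trans e (⊕-comm z x)))

⊕-identityˡ-unique : {x y : V n} → x ⊕ y ≡ y → x ≡ zeroV
⊕-identityˡ-unique {y = y} e = ⊕-cancelʳ (trans e (sym (⊕-identityˡ y)))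

⊕-identityʳ-unique : {x y : V n} → x ⊕ y ≡ x → y ≡ zeroV
⊕-identityʳ-unique {x = x} e = ⊕-cancelˡ (trans e (sym (⊕-identityʳ x)))

scale : Bool → V n → V n
scale b r = if b then r else zeroV

scale-xor : (b c : Bool) (r : V n) → scale (b xor c) r ≡ scale b r ⊕ scale c r
scale-xor false c     r = sym (⊕-identityˡ (scale c r))
scale-xor true  false r = sym (⊕-identityʳ r)
scale-xor true  true  r = sym (⊕-self r)

scale-∧ : (b c : Bool) (r : V n) → scale b (scale c r) ≡ scale (b ∧ c) r
scale-∧ true  c r = refl
scale-∧ false c r = refl

scale-⊕ : (b : Bool) (r s : V n) → scale b (r ⊕ s) ≡ scale b r ⊕ scale b s
scale-⊕ true  r s = refl
scale-⊕ false r s = sym (⊕-identityˡ zeroV)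

scale-false∷ : (b : Bool) (r : V n) → scale b (false ∷ r) ≡ false ∷ scale b r
scale-false∷ true  r = refl
scale-false∷ false r = refl

·-zeroˡ : (A : Vec (V n) m) → zeroV · A ≡ zeroV
·-zeroˡ []      = refl
·-zeroˡ (r ∷ A) = trans (⊕-identityˡ (zeroV · A)) (·-zeroˡ A)

·-distribʳ-⊕ : (x y : Vec Bool m) (A : Vec (V n) m) → (x ⊕ y) · A ≡ (x · A) ⊕ (y · A)
·-distribʳ-⊕ []      []      []      = sym (⊕-identityˡ zeroV)
·-distribʳ-⊕ (b ∷ x) (c ∷ y) (r ∷ A) = begin
  scale (b xor c) r ⊕ ((x ⊕ y) · A)            ≡⟨ cong₂ _⊕_ (scale-xor b c r) (·-distribʳ-⊕ x y A) ⟩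
  (scale b r ⊕ scale c r) ⊕ ((x · A) ⊕ (y · A))  ≡⟨ ⊕-interchange _ _ _ _ ⟩
  (scale b r ⊕ (x · A)) ⊕ (scale c r ⊕ (y · A))  ∎

·-distribˡ-⊕ : (x : Vec Bool m) (A B : Vec (V n) m) → x · zipWith _⊕_ A B ≡ (x · A) ⊕ (x · B)
·-distribˡ-⊕ []      []      []      = sym (⊕-identityˡ zeroV)
·-distribˡ-⊕ (b ∷ x) (r ∷ A) (s ∷ B) = begin
  scale b (r ⊕ s) ⊕ (x · zipWith _⊕_ A B)        ≡⟨ cong₂ _⊕_ (scale-⊕ b r s) (·-distribˡ-⊕ x A B) ⟩
  (scale b r ⊕ scale b s) ⊕ ((x · A) ⊕ (x · B))  ≡⟨ ⊕-interchange _ _ _ _ ⟩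
  (scale b r ⊕ (x · A)) ⊕ (scale b s ⊕ (x · B))  ∎

·-assoc : (x : Vec Bool k) (A : Vec (Vec Bool m) k) (B : Vec (V n) m) →
          (x · A) · B ≡ x · map (_· B) A
·-assoc []      []      B = ·-zeroˡ B
·-assoc (b ∷ x) (r ∷ A) B = begin
  (scale b r ⊕ (x · A)) · B          ≡⟨ ·-distribʳ-⊕ (scale b r) (x · A) B ⟩
  (scale b r · B) ⊕ ((x · A) · B)    ≡⟨ cong₂ _⊕_ (scale-· b) (·-assoc x A B) ⟩
  scale b (r · B) ⊕ (x · map (_· B) A) ∎
  where
  scale-· : ∀ b → scale b r · B ≡ scale b (r · B)
  scale-· true  = refl
  scale-· false = ·-zeroˡ B

idMat-suc : idMat {suc n} ≡ (true ∷ zeroV) ∷ map (false ∷_) idMat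
idMat-suc {n} = cong₂ _∷_
  (cong (true ∷_) (trans (tabulate-allFin _) (map-const (allFin n) false)))
  (trans (tabulate-cong λ i → cong (false ∷_) (tabulate-cong λ j → ⌊suc≟suc⌋ i j))
         (tabulate-∘ (false ∷_) (λ (i : Fin n) → tabulate λ j → ⌊ i ≟F j ⌋)))
  where
  ⌊suc≟suc⌋ : (i j : Fin n) → ⌊ Fin.suc i ≟F Fin.suc j ⌋ ≡ ⌊ i ≟F j ⌋
  ⌊suc≟suc⌋ i j = ⌊⌋-map′ (cong Fin.suc) suc-injective (i ≟F j)

·-map-false∷ : (x : Vec Bool m) (A : Vec (V n) m) → x · map (false ∷_) A ≡ false ∷ (x · A)
·-map-false∷ []      []      = refl
·-map-false∷ (b ∷ x) (r ∷ A) = cong₂ _⊕_ (scale-false∷ b r) (·-map-false∷ x A)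

·-identityʳ : (x : V n) → x · idMat ≡ x
·-identityʳ []      = refl
·-identityʳ (b ∷ x) = begin
  (b ∷ x) · idMat
    ≡⟨ cong ((b ∷ x) ·_) idMat-suc ⟩
  scale b (true ∷ zeroV) ⊕ (x · map (false ∷_) idMat)
    ≡⟨ cong (scale b (true ∷ zeroV) ⊕_) (·-map-false∷ x idMat) ⟩
  scale b (true ∷ zeroV) ⊕ (false ∷ (x · idMat))
    ≡⟨ leading b ⟩
  b ∷ (zeroV ⊕ (x · idMat))
    ≡⟨ cong (b ∷_) (trans (⊕-identityˡ _) (·-identityʳ x)) ⟩
  b ∷ x
    ∎
  where
  leading : ∀ b → scale b (true ∷ zeroV) ⊕ (false ∷ (x · idMat)) ≡ b ∷ (zeroV ⊕ (x · idMat))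
  leading true  = refl
  leading false = refl

idMat-· : (A : Vec (V m) n) → map (_· A) idMat ≡ A
idMat-· []      = refl
idMat-· (r ∷ A) = begin
  map (_· (r ∷ A)) idMat                                      ≡⟨ cong (map (_· (r ∷ A))) idMat-suc ⟩
  (r ⊕ (zeroV · A)) ∷ map (_· (r ∷ A)) (map (false ∷_) idMat) ≡⟨ cong₂ _∷_ head-row tail-rows ⟩
  r ∷ map (_· A) idMat                                        ≡⟨ cong (r ∷_) (idMat-· A) ⟩
  r ∷ A                                                       ∎
  where
  head-row : r ⊕ (zeroV · A) ≡ r
  head-row = trans (cong (r ⊕_) (·-zeroˡ A)) (⊕-identityʳ r)
  tail-rows : map (_· (r ∷ A)) (map (false ∷_) idMat) ≡ map (_· A) idMat
  tail-rows = trans (sym (map-∘ _ _ idMat)) (map-cong (λ e → ⊕-identityˡ (e · A)) idMat)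

⊗-identityʳ : (A : Mat n) → A ⊗ idMat ≡ A
⊗-identityʳ A = trans (map-cong ·-identityʳ A) (map-id A)

⊗-assoc : (A B C : Mat n) → (A ⊗ B) ⊗ C ≡ A ⊗ (B ⊗ C)
⊗-assoc A B C = trans (sym (map-∘ (_· C) (_· B) A)) (map-cong (λ r → ·-assoc r B C) A)

Mat-ext : (A B : Mat n) → (∀ x → x · A ≡ x · B) → A ≡ B
Mat-ext A B xA≡xB = begin
  A                 ≡⟨ idMat-· A ⟨
  map (_· A) idMat  ≡⟨ map-cong xA≡xB idMat ⟩
  map (_· B) idMat  ≡⟨ idMat-· B ⟩
  B                 ∎

·-cancel-inverse : {A B : Mat n} → A ⊗ B ≡ idMat → (x : V n) → (x · A) · B ≡ x
·-cancel-inverse {A = A} {B} AB≡I x =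
  trans (·-assoc x A B) (trans (cong (x ·_) AB≡I) (·-identityʳ x))

Invertible-⊗ : {A B : Mat n} → Invertible A → Invertible B → Invertible (A ⊗ B)
Invertible-⊗ {A = A} {B} (A⁻¹ , AA⁻¹≡I , A⁻¹A≡I) (B⁻¹ , BB⁻¹≡I , B⁻¹B≡I) =
  B⁻¹ ⊗ A⁻¹ , cancel A B B⁻¹ A⁻¹ BB⁻¹≡I AA⁻¹≡I , cancel B⁻¹ A⁻¹ A B A⁻¹A≡I B⁻¹B≡I
  where
  cancel : (P Q Q′ P′ : Mat _) → Q ⊗ Q′ ≡ idMat → P ⊗ P′ ≡ idMat → (P ⊗ Q) ⊗ (Q′ ⊗ P′) ≡ idMat
  cancel P Q Q′ P′ QQ′≡I PP′≡I = begin
    (P ⊗ Q) ⊗ (Q′ ⊗ P′)  ≡⟨ ⊗-assoc P Q (Q′ ⊗ P′) ⟩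
    P ⊗ (Q ⊗ (Q′ ⊗ P′))  ≡⟨ cong (P ⊗_) (⊗-assoc Q Q′ P′) ⟨
    P ⊗ ((Q ⊗ Q′) ⊗ P′)  ≡⟨ cong (λ M → P ⊗ (M ⊗ P′)) QQ′≡I ⟩
    P ⊗ (idMat ⊗ P′)     ≡⟨ cong (P ⊗_) (idMat-· P′) ⟩
    P ⊗ P′               ≡⟨ PP′≡I ⟩
    idMat                ∎

InAGL-cong : {g h : V n → V n} → (∀ x → g x ≡ h x) → InAGL g → InAGL h
InAGL-cong g≗h (A , b , A-inv , g-eq) = A , b , A-inv , λ x → trans (sym (g≗h x)) (g-eq x)

InAGL-∘ : {g h : V n → V n} → InAGL g → InAGL h → InAGL (g ∘ h)
InAGL-∘ {g = g} {h} (A , b , A-inv , g-eq) (C , d , C-inv , h-eq) =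
  C ⊗ A , (d · A) ⊕ b , Invertible-⊗ C-inv A-inv , λ x → begin
    g (h x)                          ≡⟨ g-eq (h x) ⟩
    (h x · A) ⊕ b                    ≡⟨ cong (λ y → (y · A) ⊕ b) (h-eq x) ⟩
    (((x · C) ⊕ d) · A) ⊕ b          ≡⟨ cong (_⊕ b) (·-distribʳ-⊕ (x · C) d A) ⟩
    (((x · C) · A) ⊕ (d · A)) ⊕ b    ≡⟨ cong (λ y → (y ⊕ (d · A)) ⊕ b) (·-assoc x C A) ⟩
    ((x · (C ⊗ A)) ⊕ (d · A)) ⊕ b    ≡⟨ ⊕-assoc _ _ _ ⟩
    (x · (C ⊗ A)) ⊕ ((d · A) ⊕ b)    ∎

id∈AGL : InAGL {n} id
id∈AGL = idMat , zeroV , (idMat , ⊗-identityʳ idMat , ⊗-identityʳ idMat) ,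
         λ x → sym (trans (⊕-identityʳ (x · idMat)) (·-identityʳ x))

InAGL⇒injective : {h : V n → V n} → InAGL h → ∀ {x y} → h x ≡ h y → x ≡ y
InAGL⇒injective {h = h} (A , b , (A⁻¹ , AA⁻¹≡I , _) , h-eq) {x} {y} hx≡hy = begin
  x              ≡⟨ ·-cancel-inverse AA⁻¹≡I x ⟨
  (x · A) · A⁻¹  ≡⟨ cong (_· A⁻¹) xA≡yA ⟩
  (y · A) · A⁻¹  ≡⟨ ·-cancel-inverse AA⁻¹≡I y ⟩
  y              ∎
  where
  xA≡yA : x · A ≡ y · A
  xA≡yA = ⊕-cancelʳ (trans (sym (h-eq x)) (trans hx≡hy (h-eq y)))

InAGL⇒surjective : {h : V n → V n} → InAGL h → ∀ y → ∃ λ x → h x ≡ y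
InAGL⇒surjective {h = h} (A , b , (A⁻¹ , _ , A⁻¹A≡I) , h-eq) y = (y ⊕ b) · A⁻¹ , (begin
  h ((y ⊕ b) · A⁻¹)            ≡⟨ h-eq _ ⟩
  (((y ⊕ b) · A⁻¹) · A) ⊕ b    ≡⟨ cong (_⊕ b) (·-cancel-inverse A⁻¹A≡I (y ⊕ b)) ⟩
  (y ⊕ b) ⊕ b                  ≡⟨ [x⊕y]⊕y≡x y b ⟩
  y                            ∎)

PreservesSum₃ : (V n → V n) → Set
PreservesSum₃ h = ∀ x y z → h ((x ⊕ y) ⊕ z) ≡ (h x ⊕ h y) ⊕ h z

InAGL⇒preservesSum₃ : {h : V n → V n} → InAGL h → PreservesSum₃ h
InAGL⇒preservesSum₃ {h = h} (A , b , _ , h-eq) x y z = begin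
  h ((x ⊕ y) ⊕ z)                                  ≡⟨ h-eq _ ⟩
  (((x ⊕ y) ⊕ z) · A) ⊕ b                          ≡⟨ cong (_⊕ b) linear ⟩
  (((x · A) ⊕ (y · A)) ⊕ (z · A)) ⊕ b              ≡⟨ ⊕-assoc _ _ _ ⟩
  ((x · A) ⊕ (y · A)) ⊕ ((z · A) ⊕ b)              ≡⟨ cong (_⊕ ((z · A) ⊕ b)) translations-cancel ⟨
  (((x · A) ⊕ b) ⊕ ((y · A) ⊕ b)) ⊕ ((z · A) ⊕ b)  ≡⟨ cong₂ _⊕_ (cong₂ _⊕_ (h-eq x) (h-eq y)) (h-eq z) ⟨
  (h x ⊕ h y) ⊕ h z                                ∎
  where
  linear : ((x ⊕ y) ⊕ z) · A ≡ ((x · A) ⊕ (y · A)) ⊕ (z · A)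
  linear = trans (·-distribʳ-⊕ (x ⊕ y) z A) (cong (_⊕ (z · A)) (·-distribʳ-⊕ x y A))
  translations-cancel : ((x · A) ⊕ b) ⊕ ((y · A) ⊕ b) ≡ (x · A) ⊕ (y · A)
  translations-cancel = begin
    ((x · A) ⊕ b) ⊕ ((y · A) ⊕ b)  ≡⟨ ⊕-interchange _ _ _ _ ⟩
    ((x · A) ⊕ (y · A)) ⊕ (b ⊕ b)  ≡⟨ cong (((x · A) ⊕ (y · A)) ⊕_) (⊕-self b) ⟩
    ((x · A) ⊕ (y · A)) ⊕ zeroV    ≡⟨ ⊕-identityʳ _ ⟩
    (x · A) ⊕ (y · A)              ∎

preservesSum₃-factor : {f g h : V n → V n} → InAGL f → (∀ x → g x ≡ h (f x)) →
                       PreservesSum₃ g → PreservesSum₃ h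
preservesSum₃-factor {f = f} {g} {h} f∈AGL g≗h∘f g-sum u v w
  with InAGL⇒surjective f∈AGL u | InAGL⇒surjective f∈AGL v | InAGL⇒surjective f∈AGL w
... | x , refl | y , refl | z , refl = begin
  h ((f x ⊕ f y) ⊕ f z)          ≡⟨ cong h (InAGL⇒preservesSum₃ f∈AGL x y z) ⟨
  h (f ((x ⊕ y) ⊕ z))            ≡⟨ g≗h∘f _ ⟨
  g ((x ⊕ y) ⊕ z)                ≡⟨ g-sum x y z ⟩
  (g x ⊕ g y) ⊕ g z              ≡⟨ cong₂ _⊕_ (cong₂ _⊕_ (g≗h∘f x) (g≗h∘f y)) (g≗h∘f z) ⟩
  (h (f x) ⊕ h (f y)) ⊕ h (f z)  ∎

swap : V n → V n → V n → V n
swap u v x with x ≟V u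
... | yes _ = v
... | no _ with x ≟V v
...   | yes _ = u
...   | no _  = x

swap-left : (u v : V n) → swap u v u ≡ v
swap-left u v with u ≟V u
... | yes _   = refl
... | no u≢u  = contradiction refl u≢u

swap-right : (u v : V n) → swap u v v ≡ u
swap-right u v with v ≟V u
... | yes v≡u = v≡u
... | no _ with v ≟V v
...   | yes _   = refl
...   | no v≢v  = contradiction refl v≢v

swap-other : {u v x : V n} → x ≢ u → x ≢ v → swap u v x ≡ x
swap-other {u = u} {v} {x} x≢u x≢v with x ≟V u
... | yes x≡u = contradiction x≡u x≢u
... | no _ with x ≟V v
...   | yes x≡v = contradiction x≡v x≢v
...   | no _    = refl

swap-natural : (f : V n → V n) → (∀ {x y} → f x ≡ f y → x ≡ y) →
               (u v x : V n) → f (swap u v x) ≡ swap (f u) (f v) (f x)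
-- Deciding u ≟V x rather than x ≟V u keeps `with` from abstracting inside swap u v x.
swap-natural f f-inj u v x with u ≟V x | v ≟V x
... | yes refl | _        = trans (cong f (swap-left u v)) (sym (swap-left (f u) (f v)))
... | no _     | yes refl = trans (cong f (swap-right u v)) (sym (swap-right (f u) (f v)))
... | no u≢x   | no v≢x   = trans (cong f (swap-other (u≢x ∘ sym) (v≢x ∘ sym)))
                                 (sym (swap-other (u≢x ∘ sym ∘ f-inj) (v≢x ∘ sym ∘ f-inj)))

transp≗swap : (a x : V n) → transp a x ≡ swap zeroV a x
transp≗swap a x with x ≟V zeroV
... | yes _ = refl
... | no _ with x ≟V a
...   | yes _ = refl
...   | no _  = refl

transp-zero : (a : V n) → transp a zeroV ≡ a
transp-zero a = trans (transp≗swap a zeroV) (swap-left zeroV a)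

transp-self : (a : V n) → transp a a ≡ zeroV
transp-self a = trans (transp≗swap a a) (swap-right zeroV a)

transp-outside : {a x : V n} → ¬ InPair a x → transp a x ≡ x
transp-outside {a = a} {x} x∉ =
  trans (transp≗swap a x) (swap-other (x∉ ∘ inj₁) (x∉ ∘ inj₂))

transp-inPair : {a x : V n} → InPair a x → transp a x ≡ x ⊕ a
transp-inPair {a = a} (inj₁ refl) = trans (transp-zero a) (sym (⊕-identityˡ a))
transp-inPair {a = a} (inj₂ refl) = trans (transp-self a) (sym (⊕-self a))

transp-mixed-sum : {a p q : V n} → InPair a p → ¬ InPair a q → transp a q ⊕ transp a p ≡ (p ⊕ q) ⊕ a
transp-mixed-sum {a = a} {p} {q} p∈ q∉ = begin
  transp a q ⊕ transp a p  ≡⟨ cong₂ _⊕_ (transp-outside q∉) (transp-inPair p∈) ⟩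
  q ⊕ (p ⊕ a)              ≡⟨ ⊕-assoc q p a ⟨
  (q ⊕ p) ⊕ a              ≡⟨ cong (_⊕ a) (⊕-comm q p) ⟩
  (p ⊕ q) ⊕ a              ∎

inPair? : (a x : V n) → Dec (InPair a x)
inPair? a x = x ≟V zeroV ⊎-dec x ≟V a

pair-partner : {a p q : V n} → p ≢ q → InPair a p → InPair a q → transp a q ≡ p
pair-partner {a = a} _   (inj₁ refl) (inj₂ refl) = transp-self a
pair-partner {a = a} _   (inj₂ refl) (inj₁ refl) = transp-zero a
pair-partner         p≢q (inj₁ refl) (inj₁ refl) = contradiction refl p≢q
pair-partner         p≢q (inj₂ refl) (inj₂ refl) = contradiction refl p≢q

pair-sum : {a p q : V n} → p ≢ q → InPair a p → InPair a q → p ⊕ q ≡ a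
pair-sum _   (inj₁ refl) (inj₂ refl) = ⊕-identityˡ _
pair-sum _   (inj₂ refl) (inj₁ refl) = ⊕-identityʳ _
pair-sum p≢q (inj₁ refl) (inj₁ refl) = contradiction refl p≢q
pair-sum p≢q (inj₂ refl) (inj₂ refl) = contradiction refl p≢q

pair-covers : {a p q y : V n} → p ≢ q → InPair a p → InPair a q → InPair a y → y ≡ p ⊎ y ≡ q
pair-covers _   (inj₁ refl) (inj₂ refl) (inj₁ refl) = inj₁ refl
pair-covers _   (inj₁ refl) (inj₂ refl) (inj₂ refl) = inj₂ refl
pair-covers _   (inj₂ refl) (inj₁ refl) (inj₁ refl) = inj₂ refl
pair-covers _   (inj₂ refl) (inj₁ refl) (inj₂ refl) = inj₁ refl
pair-covers p≢q (inj₁ refl) (inj₁ refl) _           = contradiction refl p≢q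
pair-covers p≢q (inj₂ refl) (inj₂ refl) _           = contradiction refl p≢q

partner-inPair : {a p : V n} → InPair a p → InPair a (p ⊕ a)
partner-inPair {a = a} (inj₁ refl) = inj₂ (⊕-identityˡ a)
partner-inPair {a = a} (inj₂ refl) = inj₁ (⊕-self a)

partner-outside : {a p : V n} → ¬ InPair a p → ¬ InPair a (p ⊕ a)
partner-outside p∉ = [ p∉ ∘ inj₂ ∘ sym ∘ x⊕y≡0⇒y≡x , p∉ ∘ inj₁ ∘ ⊕-identityˡ-unique ]′

-- Avoiding a short list of vectors

fibre : Bool → List (V (suc n)) → List (V n)
fibre b []            = []
fibre b ((c ∷ v) ∷ L) with c ≟B b
... | yes _ = v ∷ fibre b L
... | no _  = fibre b L

fibre-length : (L : List (V (suc n))) → length (fibre false L) + length (fibre true L) ≡ length L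
fibre-length []                = refl
fibre-length ((false ∷ v) ∷ L) = cong suc (fibre-length L)
fibre-length ((true  ∷ v) ∷ L) = trans (+-suc _ _) (cong suc (fibre-length L))

avoid-fibre : (b : Bool) {v : V n} (L : List (V (suc n))) → All (v ≢_) (fibre b L) → All ((b ∷ v) ≢_) L
avoid-fibre b []            [] = []
avoid-fibre b ((c ∷ w) ∷ L) v∉ with c ≟B b
avoid-fibre b ((c ∷ w) ∷ L) (v≢w ∷ v∉) | yes refl = (v≢w ∘ ∷-injectiveʳ) ∷ avoid-fibre b L v∉
avoid-fibre b ((c ∷ w) ∷ L) v∉         | no c≢b   = (c≢b ∘ sym ∘ ∷-injectiveˡ) ∷ avoid-fibre b L v∉

∃-avoiding : (L : List (V n)) → length L < 2 ^ n → ∃ λ v → All (v ≢_) L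
∃-avoiding {zero}  []      _ = [] , []
∃-avoiding {zero}  (_ ∷ _) (s≤s ())
∃-avoiding {suc n} L |L|<2^[1+n] with length (fibre false L) <? 2 ^ n
... | yes |F|<2^n = let v , v∉ = ∃-avoiding (fibre false L) |F|<2^n in false ∷ v , avoid-fibre false L v∉
... | no  |F|≮2^n = let v , v∉ = ∃-avoiding (fibre true L) |T|<2^n in true ∷ v , avoid-fibre true L v∉
  where
  2^n+|T|≤|L| : 2 ^ n + length (fibre true L) ≤ length L
  2^n+|T|≤|L| = ≤-trans (+-monoˡ-≤ _ (≮⇒≥ |F|≮2^n)) (≤-reflexive (fibre-length L))
  |L|<2^n+2^n : length L < 2 ^ n + 2 ^ n
  |L|<2^n+2^n = subst (length L <_) (cong (2 ^ n +_) (+-identityʳ (2 ^ n))) |L|<2^[1+n]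
  |T|<2^n : length (fibre true L) < 2 ^ n
  |T|<2^n = +-cancelˡ-< (2 ^ n) _ _ (≤-<-trans 2^n+|T|≤|L| |L|<2^n+2^n)

∃-avoiding-≤ : k ≤ n → (L : List (V n)) → {True (length L <? 2 ^ k)} → ∃ λ v → All (v ≢_) L
∃-avoiding-≤ {k} k≤n L {|L|<2^k} = ∃-avoiding L (<-≤-trans (toWitness |L|<2^k) (^-monoʳ-≤ 2 k≤n))

-- The double transposition (0 a)(p q)

module _ {a p q : V n} where

  sum-shift : PreservesSum₃ (transp a ∘ swap p q) → ∀ u → u ≢ p → u ≢ q →
              transp a ((p ⊕ q) ⊕ u) ≡ (transp a q ⊕ transp a p) ⊕ transp a u
  sum-shift κ-sum u u≢p u≢q = begin
    transp a ((p ⊕ q) ⊕ u)                   ≡⟨ cong (transp a) (swap-other s≢p s≢q) ⟨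
    transp a (swap p q ((p ⊕ q) ⊕ u))        ≡⟨ κ-sum p q u ⟩
    (transp a (swap p q p) ⊕ transp a (swap p q q)) ⊕ transp a (swap p q u)
      ≡⟨ cong₂ _⊕_ (cong₂ _⊕_ (cong (transp a) (swap-left p q)) (cong (transp a) (swap-right p q)))
                   (cong (transp a) (swap-other u≢p u≢q)) ⟩
    (transp a q ⊕ transp a p) ⊕ transp a u   ∎
    where
    s≢p : (p ⊕ q) ⊕ u ≢ p
    s≢p s≡p = u≢q (trans (x⊕y≡z⇒y≡x⊕z s≡p) ([x⊕y]⊕x≡y p q))
    s≢q : (p ⊕ q) ⊕ u ≢ q
    s≢q s≡q = u≢p (trans (x⊕y≡z⇒y≡x⊕z s≡q) ([x⊕y]⊕y≡x p q))

  transp-pair-sum : 3 ≤ n → PreservesSum₃ (transp a ∘ swap p q) → transp a q ⊕ transp a p ≡ p ⊕ q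
  transp-pair-sum 3≤n κ-sum
    with ∃-avoiding-≤ 3≤n (p ∷ q ∷ zeroV ∷ a ∷ (p ⊕ q) ∷ ((p ⊕ q) ⊕ a) ∷ [])
  ... | u , u≢p ∷ u≢q ∷ u≢0 ∷ u≢a ∷ u≢s ∷ u≢s⊕a ∷ [] = ⊕-cancelʳ (begin
    (transp a q ⊕ transp a p) ⊕ u           ≡⟨ cong (_ ⊕_) (transp-outside [ u≢0 , u≢a ]′) ⟨
    (transp a q ⊕ transp a p) ⊕ transp a u  ≡⟨ sum-shift κ-sum u u≢p u≢q ⟨
    transp a ((p ⊕ q) ⊕ u)                  ≡⟨ transp-outside s∉ ⟩
    (p ⊕ q) ⊕ u                             ∎)
    where
    s∉ : ¬ InPair a ((p ⊕ q) ⊕ u)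
    s∉ = [ u≢s ∘ x⊕y≡0⇒y≡x , u≢s⊕a ∘ x⊕y≡z⇒y≡x⊕z ]′

  pair⊎outside : a ≢ zeroV → 3 ≤ n → PreservesSum₃ (transp a ∘ swap p q) →
                 (InPair a p × InPair a q) ⊎ (¬ InPair a p × ¬ InPair a q)
  pair⊎outside a≢0 3≤n κ-sum with inPair? a p | inPair? a q
  ... | yes p∈ | yes q∈ = inj₁ (p∈ , q∈)
  ... | no p∉  | no q∉  = inj₂ (p∉ , q∉)
  ... | yes p∈ | no q∉  = ⊥-elim (a≢0 (⊕-identityʳ-unique (begin
    (p ⊕ q) ⊕ a              ≡⟨ transp-mixed-sum p∈ q∉ ⟨
    transp a q ⊕ transp a p  ≡⟨ transp-pair-sum 3≤n κ-sum ⟩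
    p ⊕ q                    ∎)))
  ... | no p∉  | yes q∈ = ⊥-elim (a≢0 (⊕-identityʳ-unique (begin
    (q ⊕ p) ⊕ a              ≡⟨ transp-mixed-sum q∈ p∉ ⟨
    transp a p ⊕ transp a q  ≡⟨ ⊕-comm _ _ ⟩
    transp a q ⊕ transp a p  ≡⟨ transp-pair-sum 3≤n κ-sum ⟩
    p ⊕ q                    ≡⟨ ⊕-comm p q ⟩
    q ⊕ p                    ∎)))

  swap-fixes : {x : V n} → ¬ InPair a x → x ≢ p → x ≢ q → transp a (swap p q x) ≡ x
  swap-fixes x∉ x≢p x≢q = trans (cong (transp a) (swap-other x≢p x≢q)) (transp-outside x∉)

  outside⇒sum≡a : a ≢ zeroV → p ≢ q → PreservesSum₃ (transp a ∘ swap p q) →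
                  ¬ InPair a p → ¬ InPair a q → p ⊕ q ≡ a
  outside⇒sum≡a a≢0 p≢q κ-sum p∉ q∉ with inPair? a (p ⊕ q)
  ... | yes (inj₁ s≡0) = contradiction (sym (x⊕y≡0⇒y≡x s≡0)) p≢q
  ... | yes (inj₂ s≡a) = s≡a
  ... | no s∉          = contradiction (⊕-identityʳ-unique (begin
    (p ⊕ q) ⊕ a
      ≡⟨ cong (_⊕ a) (⊕-comm p q) ⟩
    (q ⊕ p) ⊕ a
      ≡⟨ cong₂ _⊕_ (cong₂ _⊕_ (transp-outside q∉) (transp-outside p∉)) (transp-zero a) ⟨
    (transp a q ⊕ transp a p) ⊕ transp a zeroV
      ≡⟨ sum-shift κ-sum zeroV (p∉ ∘ inj₁ ∘ sym) (q∉ ∘ inj₁ ∘ sym) ⟨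
    transp a ((p ⊕ q) ⊕ zeroV)
      ≡⟨ cong (transp a) (⊕-identityʳ (p ⊕ q)) ⟩
    transp a (p ⊕ q)
      ≡⟨ transp-outside s∉ ⟩
    p ⊕ q
      ∎)) a≢0

  outside-impossible : a ≢ zeroV → 4 ≤ n → PreservesSum₃ (transp a ∘ swap p q) →
                       ¬ InPair a p → ¬ InPair a q → ⊥
  outside-impossible a≢0 4≤n κ-sum p∉ q∉
    with ∃-avoiding-≤ 4≤n (zeroV ∷ a ∷ p ∷ q ∷ [])
  ... | u , u≢0 ∷ u≢a ∷ u≢p ∷ u≢q ∷ []
    with ∃-avoiding-≤ 4≤n (u ∷ (u ⊕ a) ∷ (u ⊕ p) ∷ (u ⊕ q) ∷ zeroV ∷ a ∷ p ∷ q ∷ [])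
  ... | w , w≢u ∷ w≢u⊕a ∷ w≢u⊕p ∷ w≢u⊕q ∷ w≢0 ∷ w≢a ∷ w≢p ∷ w≢q ∷ [] =
    a≢0 (⊕-identityˡ-unique (⊕-cancelʳ (begin
      (a ⊕ u) ⊕ w                       ≡⟨ cong₂ _⊕_ (cong₂ _⊕_ κ0≡a κu≡u) κw≡w ⟨
      (κ zeroV ⊕ κ u) ⊕ κ w             ≡⟨ κ-sum zeroV u w ⟨
      κ ((zeroV ⊕ u) ⊕ w)               ≡⟨ cong (λ x → κ (x ⊕ w)) (⊕-identityˡ u) ⟩
      κ (u ⊕ w)                         ≡⟨ κ[u⊕w]≡u⊕w ⟩
      u ⊕ w                             ∎)))
    where
    κ : V n → V n
    κ = transp a ∘ swap p q
    κ0≡a : κ zeroV ≡ a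
    κ0≡a = trans (cong (transp a) (swap-other (p∉ ∘ inj₁ ∘ sym) (q∉ ∘ inj₁ ∘ sym))) (transp-zero a)
    κu≡u : κ u ≡ u
    κu≡u = swap-fixes [ u≢0 , u≢a ]′ u≢p u≢q
    κw≡w : κ w ≡ w
    κw≡w = swap-fixes [ w≢0 , w≢a ]′ w≢p w≢q
    κ[u⊕w]≡u⊕w : κ (u ⊕ w) ≡ u ⊕ w
    κ[u⊕w]≡u⊕w = swap-fixes [ w≢u ∘ x⊕y≡0⇒y≡x , w≢u⊕a ∘ x⊕y≡z⇒y≡x⊕z ]′
                            (w≢u⊕p ∘ x⊕y≡z⇒y≡x⊕z) (w≢u⊕q ∘ x⊕y≡z⇒y≡x⊕z)

  preservesSum₃⇒sum≡a : a ≢ zeroV → p ≢ q → 3 ≤ n → PreservesSum₃ (transp a ∘ swap p q) → p ⊕ q ≡ a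
  preservesSum₃⇒sum≡a a≢0 p≢q 3≤n κ-sum with pair⊎outside a≢0 3≤n κ-sum
  ... | inj₁ (p∈ , q∈) = pair-sum p≢q p∈ q∈
  ... | inj₂ (p∉ , q∉) = outside⇒sum≡a a≢0 p≢q κ-sum p∉ q∉

  preservesSum₃⇒pair : a ≢ zeroV → 4 ≤ n → PreservesSum₃ (transp a ∘ swap p q) → InPair a p × InPair a q
  preservesSum₃⇒pair a≢0 4≤n κ-sum with pair⊎outside a≢0 (<⇒≤ 4≤n) κ-sum
  ... | inj₁ p∈,q∈     = p∈,q∈
  ... | inj₂ (p∉ , q∉) = ⊥-elim (outside-impossible a≢0 4≤n κ-sum p∉ q∉)

  pair⇒swap-cancels : p ≢ q → InPair a p → InPair a q → ∀ x → transp a (swap p q x) ≡ x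
  pair⇒swap-cancels p≢q p∈ q∈ x with p ≟V x | q ≟V x
  ... | yes refl | _        = trans (cong (transp a) (swap-left p q)) (pair-partner p≢q p∈ q∈)
  ... | no _     | yes refl = trans (cong (transp a) (swap-right p q)) (pair-partner (p≢q ∘ sym) q∈ p∈)
  ... | no p≢x   | no q≢x   = swap-fixes x∉ (p≢x ∘ sym) (q≢x ∘ sym)
    where
    x∉ : ¬ InPair a x
    x∉ x∈ = [ p≢x ∘ sym , q≢x ∘ sym ]′ (pair-covers p≢q p∈ q∈ x∈)

  pair⇒∈AGL : p ≢ q → InPair a p → InPair a q → InAGL (transp a ∘ swap p q)
  pair⇒∈AGL p≢q p∈ q∈ = InAGL-cong (sym ∘ pair⇒swap-cancels p≢q p∈ q∈) id∈AGL

-- Transvections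

_∙_ : Vec Bool n → Vec Bool n → Bool
[]      ∙ []      = false
(x ∷ u) ∙ (c ∷ w) = (x ∧ c) xor (u ∙ w)

∙-zeroˡ : (c : Vec Bool n) → zeroV ∙ c ≡ false
∙-zeroˡ []      = refl
∙-zeroˡ (_ ∷ c) = ∙-zeroˡ c

scale-∙ : (b : Bool) {a c : V n} → a ∙ c ≡ false → scale b a ∙ c ≡ false
scale-∙ true      a∙c≡0 = a∙c≡0
scale-∙ false {c = c} _ = ∙-zeroˡ c

outer : Vec Bool m → V n → Vec (V n) m
outer c a = map (λ cᵢ → scale cᵢ a) c

·-outer : (u c : Vec Bool m) (a : V n) → u · outer c a ≡ scale (u ∙ c) a
·-outer []      []      a = refl
·-outer (x ∷ u) (c ∷ w) a = begin
  scale x (scale c a) ⊕ (u · outer w a)  ≡⟨ cong₂ _⊕_ (scale-∧ x c a) (·-outer u w a) ⟩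
  scale (x ∧ c) a ⊕ scale (u ∙ w) a      ≡⟨ scale-xor (x ∧ c) (u ∙ w) a ⟨
  scale ((x ∧ c) xor (u ∙ w)) a          ∎

transvection : V n → V n → Mat n
transvection c a = zipWith _⊕_ idMat (outer c a)

·-transvection : (u c a : V n) → u · transvection c a ≡ u ⊕ scale (u ∙ c) a
·-transvection u c a =
  trans (·-distribˡ-⊕ u idMat (outer c a)) (cong₂ _⊕_ (·-identityʳ u) (·-outer u c a))

transvection-fixes : {v c : V n} (a : V n) → v ∙ c ≡ false → v · transvection c a ≡ v
transvection-fixes {v = v} {c} a v∙c≡0 =
  trans (·-transvection v c a) (trans (cong (λ b → v ⊕ scale b a) v∙c≡0) (⊕-identityʳ v))

transvection-involutive : {a c : V n} → a ∙ c ≡ false →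
                          transvection c a ⊗ transvection c a ≡ idMat
transvection-involutive {a = a} {c} a∙c≡0 = Mat-ext _ _ λ u → begin
  u · (T ⊗ T)                              ≡⟨ ·-assoc u T T ⟨
  (u · T) · T                              ≡⟨ cong (_· T) (·-transvection u c a) ⟩
  (u ⊕ scale (u ∙ c) a) · T                ≡⟨ ·-distribʳ-⊕ u _ T ⟩
  (u · T) ⊕ (scale (u ∙ c) a · T)          ≡⟨ cong₂ _⊕_ (·-transvection u c a)
                                                        (transvection-fixes a (scale-∙ (u ∙ c) a∙c≡0)) ⟩
  (u ⊕ scale (u ∙ c) a) ⊕ scale (u ∙ c) a  ≡⟨ [x⊕y]⊕y≡x u _ ⟩
  u                                        ≡⟨ ·-identityʳ u ⟨
  u · idMat                                ∎
  where
  T : Mat _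
  T = transvection c a

plane : V n → V n → List (V n)
plane a p = zeroV ∷ a ∷ p ∷ (p ⊕ a) ∷ []

KernelIs : V n → List (V n) → Set
KernelIs c W = ∀ u → (u ∈ W → u ∙ c ≡ false) × (u ∉ W → u ∙ c ≡ true)

module _ {a p : V n} (p∉ : ¬ InPair a p) where

  private
    0≢p : zeroV ≢ p
    0≢p = p∉ ∘ inj₁ ∘ sym
    a≢p : a ≢ p
    a≢p = p∉ ∘ inj₂ ∘ sym
    p⊕a∉ : ¬ InPair a (p ⊕ a)
    p⊕a∉ = partner-outside p∉

  swap-on-plane : ∀ {u} → u ∈ plane a p → transp a (swap p (p ⊕ a) u) ≡ u ⊕ a
  swap-on-plane (here refl) = begin
    transp a (swap p (p ⊕ a) zeroV)  ≡⟨ cong (transp a) (swap-other 0≢p (p⊕a∉ ∘ inj₁ ∘ sym)) ⟩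
    transp a zeroV                   ≡⟨ transp-zero a ⟩
    a                                ≡⟨ ⊕-identityˡ a ⟨
    zeroV ⊕ a                        ∎
  swap-on-plane (there (here refl)) = begin
    transp a (swap p (p ⊕ a) a)      ≡⟨ cong (transp a) (swap-other a≢p (p⊕a∉ ∘ inj₂ ∘ sym)) ⟩
    transp a a                       ≡⟨ transp-self a ⟩
    zeroV                            ≡⟨ ⊕-self a ⟨
    a ⊕ a                            ∎
  swap-on-plane (there (there (here refl))) =
    trans (cong (transp a) (swap-left p (p ⊕ a))) (transp-outside p⊕a∉)
  swap-on-plane (there (there (there (here refl)))) = begin
    transp a (swap p (p ⊕ a) (p ⊕ a))  ≡⟨ cong (transp a) (swap-right p (p ⊕ a)) ⟩
    transp a p                         ≡⟨ transp-outside p∉ ⟩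
    p                                  ≡⟨ [x⊕y]⊕y≡x p a ⟨
    (p ⊕ a) ⊕ a                        ∎

  swap-off-plane : ∀ {u} → u ∉ plane a p → transp a (swap p (p ⊕ a) u) ≡ u
  swap-off-plane u∉ = swap-fixes [ u∉ ∘ here , u∉ ∘ there ∘ here ]′
                                 (u∉ ∘ there ∘ there ∘ here) (u∉ ∘ there ∘ there ∘ there ∘ here)

  swap-plane∈AGL : {c : V n} → KernelIs c (plane a p) → InAGL (transp a ∘ swap p (p ⊕ a))
  swap-plane∈AGL {c} ker = T , a , (T , T⊗T≡I , T⊗T≡I) , agrees
    where
    T : Mat n
    T = transvection c a
    T⊗T≡I : T ⊗ T ≡ idMat
    T⊗T≡I = transvection-involutive (proj₁ (ker a) (there (here refl)))
    agrees : ∀ u → transp a (swap p (p ⊕ a) u) ≡ (u · T) ⊕ a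
    agrees u with any? (u ≟V_) (plane a p)
    ... | yes u∈ = begin
      transp a (swap p (p ⊕ a) u)  ≡⟨ swap-on-plane u∈ ⟩
      u ⊕ a                        ≡⟨ cong (_⊕ a) (⊕-identityʳ u) ⟨
      (u ⊕ scale false a) ⊕ a      ≡⟨ cong (λ b → (u ⊕ scale b a) ⊕ a) (proj₁ (ker u) u∈) ⟨
      (u ⊕ scale (u ∙ c) a) ⊕ a    ≡⟨ cong (_⊕ a) (·-transvection u c a) ⟨
      (u · T) ⊕ a                  ∎
    ... | no u∉ = begin
      transp a (swap p (p ⊕ a) u)  ≡⟨ swap-off-plane u∉ ⟩
      u                            ≡⟨ [x⊕y]⊕y≡x u a ⟨
      (u ⊕ scale true a) ⊕ a       ≡⟨ cong (λ b → (u ⊕ scale b a) ⊕ a) (proj₂ (ker u) u∉) ⟨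
      (u ⊕ scale (u ∙ c) a) ⊕ a    ≡⟨ cong (_⊕ a) (·-transvection u c a) ⟨
      (u · T) ⊕ a                  ∎

-- Dimension three

_×₃_ : V 3 → V 3 → V 3
(a₁ ∷ a₂ ∷ a₃ ∷ []) ×₃ (p₁ ∷ p₂ ∷ p₃ ∷ []) =
  ((a₂ ∧ p₃) xor (a₃ ∧ p₂)) ∷ ((a₃ ∧ p₁) xor (a₁ ∧ p₃)) ∷ ((a₁ ∧ p₂) xor (a₂ ∧ p₁)) ∷ []

cross-kernel : (a p : V 3) → a ≢ zeroV → ¬ InPair a p → KernelIs (a ×₃ p) (plane a p)
cross-kernel a p a≢0 p∉ u = decidable-stable (claim? a p u) no-counterexample a≢0 p∉
  where
  Claim : V 3 → V 3 → V 3 → Set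
  Claim a p u = a ≢ zeroV → ¬ InPair a p →
                (u ∈ plane a p → u ∙ (a ×₃ p) ≡ false) × (u ∉ plane a p → u ∙ (a ×₃ p) ≡ true)
  claim? : ∀ a p u → Dec (Claim a p u)
  claim? a p u = ¬? (a ≟V zeroV) →-dec ¬? (inPair? a p) →-dec
                 ((u∈? →-dec (u ∙ (a ×₃ p) ≟B false)) ×-dec (¬? u∈? →-dec (u ∙ (a ×₃ p) ≟B true)))
    where
    u∈? : Dec (u ∈ plane a p)
    u∈? = any? (u ≟V_) (plane a p)
  -- V 3 is Subset 3, so anySubset? searches all 8³ triples for a counterexample.
  no-counterexample : ¬ ¬ Claim a p u
  no-counterexample ¬claim =
    from-no (anySubset? λ a → anySubset? λ p → anySubset? λ u → ¬? (claim? a p u)) (a , p , u , ¬claim)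

sum≡a⇒∈AGL₃ : n ≡ 3 → {a p q : V n} → a ≢ zeroV → p ≢ q → p ⊕ q ≡ a → InAGL (transp a ∘ swap p q)
sum≡a⇒∈AGL₃ refl {a} {p} a≢0 p≢q p⊕q≡a with x⊕y≡z⇒y≡x⊕z p⊕q≡a | inPair? a p
... | refl | yes p∈ = pair⇒∈AGL p≢q p∈ (partner-inPair p∈)
... | refl | no p∉  = swap-plane∈AGL p∉ (cross-kernel a p a≢0 p∉)

mapsPairOnto⇒pair : {a : V n} {f : V n → V n} → MapsPairOnto f a → InPair a (f zeroV) × InPair a (f a)
mapsPairOnto⇒pair {a = a} (into , _) = into zeroV (inj₁ refl) , into a (inj₂ refl)

pair⇒mapsPairOnto : {a : V n} {f : V n → V n} → f zeroV ≢ f a →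
                    InPair a (f zeroV) × InPair a (f a) → MapsPairOnto f a
pair⇒mapsPairOnto {a = a} {f} f0≢fa (f0∈ , fa∈) = into , onto
  where
  into : ∀ x → InPair a x → InPair a (f x)
  into _ (inj₁ refl) = f0∈
  into _ (inj₂ refl) = fa∈
  onto : ∀ y → InPair a y → ∃ λ x → InPair a x × f x ≡ y
  onto y y∈ with pair-covers f0≢fa f0∈ fa∈ y∈
  ... | inj₁ refl = zeroV , inj₁ refl , refl
  ... | inj₂ refl = a , inj₂ refl , refl

lemma7p4 : (n : ℕ) → 3 ≤ n → (a : V n) → a ≢ zeroV →
    (f : V n → V n) → InAGL f →
    (4 ≤ n → (InAGL (transp a ∘ f ∘ transp a) ⇔ MapsPairOnto f a)) ×
    (n ≡ 3 → (InAGL (transp a ∘ f ∘ transp a) ⇔ (f a ⊕ f zeroV ≡ a)))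
lemma7p4 n 3≤n a a≢0 f f∈AGL =
  (λ 4≤n → mk⇔ (pair⇒mapsPairOnto p≢q ∘ preservesSum₃⇒pair a≢0 4≤n ∘ κ-sum)
               (g∈AGL ∘ uncurry (pair⇒∈AGL p≢q) ∘ mapsPairOnto⇒pair)) ,
  (λ n≡3 → mk⇔ (trans (⊕-comm (f a) (f zeroV)) ∘ preservesSum₃⇒sum≡a a≢0 p≢q 3≤n ∘ κ-sum)
               (g∈AGL ∘ sum≡a⇒∈AGL₃ n≡3 a≢0 p≢q ∘ trans (⊕-comm (f zeroV) (f a))))
  where
  p≢q : f zeroV ≢ f a
  p≢q = a≢0 ∘ sym ∘ InAGL⇒injective f∈AGL
  g≗κ∘f : ∀ x → transp a (f (transp a x)) ≡ transp a (swap (f zeroV) (f a) (f x))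
  g≗κ∘f x = cong (transp a)
    (trans (cong f (transp≗swap a x)) (swap-natural f (InAGL⇒injective f∈AGL) zeroV a x))
  κ-sum : InAGL (transp a ∘ f ∘ transp a) → PreservesSum₃ (transp a ∘ swap (f zeroV) (f a))
  κ-sum g∈AGL = preservesSum₃-factor f∈AGL g≗κ∘f (InAGL⇒preservesSum₃ g∈AGL)
  g∈AGL : InAGL (transp a ∘ swap (f zeroV) (f a)) → InAGL (transp a ∘ f ∘ transp a)
  g∈AGL κ∈AGL = InAGL-cong (sym ∘ g≗κ∘f) (InAGL-∘ κ∈AGL f∈AGL)
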